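{- For every $\alpha, d\in (0,1]$, there exists $\rho>0$ such that the following holds for any sufficiently large integer $n$. Let $H$ be an $n$-vertex $(\rho,d)$-cherry-dense $3$-graph satisfying $\delta_1(H)\ge \alpha \binom{n}{2}$, and let $H'$ be a spanning subgraph of $H$ such that for every pair $S$ of vertices either $\deg_{H'}(S)\ge dn/3$ or $\deg_{H'}(S)=0$, and the number of pairs $S$ with $\deg_{H'}(S)=0$ is at most $\rho^{1/5}\binom n2$. Let $v \in V(H)$. Then, for any $W \subseteq V(H)$ with $|W| \le \alpha n /4$, there exists a $v$-absorber $(v_1,v_2,v_3,v_4)$ with $v_1,v_2,v_3,v_4\in V(H)\setminus W$ such that $\deg_{H'}(\{v_1,v_2\}) \ge d n/3$ and $\deg_{H'}(\{v_3,v_4\}) \ge d n/3$.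
   Context: A $3$-graph $H$ has vertex set $V(H)$ and edge set $E(H)$ consisting of $3$-element subsets of $V(H)$. For a set $S$ of vertices, $\deg_H(S)$ is the number of edges containing $S$; $\delta_1(H)$ is the minimum of $\deg_H(\{v\})$ over all vertices $v$. For $\vec G_1,\vec G_2 \subseteq V(H)\times V(H)$ let $\mathcal{P}_2(\vec G_1,\vec G_2)=\{(x,y,z)\in V(H)^3: (x,y)\in \vec G_1, (y,z)\in \vec G_2\}$ and $e_H(\vec G_1,\vec G_2)=|\{(x,y,z)\in \mathcal{P}_2(\vec G_1,\vec G_2): \{x,y,z\}\in E(H)\}|$. An $n$-vertex $3$-graph $H$ is $(\rho,d)$-cherry-dense if $e_H(\vec G_1,\vec G_2)\ge d|\mathcal{P}_2(\vec G_1,\vec G_2)|-\rho n^3$ for every $\vec G_1,\vec G_2\subseteq V(H)\times V(H)$. For $v\in V(H)$, a quadruple $(x,y,z,w)\in V(H)^4$ is a $v$-absorber if $\{x,y,z\},\{y,z,w\},\{v,x,y\},\{v,y,z\},\{v,z,w\}\in E(H)$.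
   Formalization: The parameters α and d range over the rationals in (0,1]. -}

module Defs where

open import Data.Nat as ℕ using (ℕ; zero; suc; _<ᵇ_)
open import Data.Nat.Combinatorics using (_C_)
open import Data.Integer using (+_)
open import Data.Rational using (ℚ; _/_; _*_; _-_; _≤_)
open import Data.Fin using (Fin; toℕ)
open import Data.List using (List; map; allFin)
open import Data.Nat.ListAction using (sum)
open import Data.Bool using (Bool; true; false; _∧_; if_then_else_)
open import Relation.Binary.PropositionalEquality using (_≡_; _≢_)
open import Data.Product using (_×_)

⟦_⟧ : ℕ → ℚ
⟦ n ⟧ = (+ n) / 1

count : ∀ {n} → (Fin n → Bool) → ℕ
count {n} P = sum (map (λ i → if P i then 1 else 0) (allFin n))

-- a 3-graph on vertex set Fin n: a set of 3-element subsets of Fin n,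
-- encoded as a symmetric boolean predicate on triples that only holds on
-- triples of pairwise distinct vertices.
record 3Graph (n : ℕ) : Set where
  field
    edge    : Fin n → Fin n → Fin n → Bool
    sym₁₂   : ∀ x y z → edge x y z ≡ edge y x z
    sym₂₃   : ∀ x y z → edge x y z ≡ edge x z y
    distinct : ∀ x y z → edge x y z ≡ true → (x ≢ y) × (y ≢ z) × (x ≢ z)
open 3Graph public

_⊆ᴴ_ : ∀ {n} → 3Graph n → 3Graph n → Set
H' ⊆ᴴ H = ∀ x y z → edge H' x y z ≡ true → edge H x y z ≡ true

deg₂ : ∀ {n} → 3Graph n → Fin n → Fin n → ℕ
deg₂ H x y = count (λ z → edge H x y z)

count₂ : ∀ {n} → (Fin n → Fin n → Bool) → ℕ
count₂ P = sum (map (λ x → count (P x)) (allFin _))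

count₃ : ∀ {n} → (Fin n → Fin n → Fin n → Bool) → ℕ
count₃ P = sum (map (λ x → count₂ (P x)) (allFin _))

deg₁ : ∀ {n} → 3Graph n → Fin n → ℕ
deg₁ H v = count₂ (λ y z → (toℕ y <ᵇ toℕ z) ∧ edge H v y z)

δ₁≥ : ∀ {n} → 3Graph n → ℚ → Set
δ₁≥ H c = ∀ v → c ≤ ⟦ deg₁ H v ⟧

|P₂| : ∀ {n} → (Fin n → Fin n → Bool) → (Fin n → Fin n → Bool) → ℕ
|P₂| G₁ G₂ = count₃ (λ x y z → G₁ x y ∧ G₂ y z)

e[_] : ∀ {n} → 3Graph n → (Fin n → Fin n → Bool) → (Fin n → Fin n → Bool) → ℕ
e[ H ] G₁ G₂ = count₃ (λ x y z → G₁ x y ∧ G₂ y z ∧ edge H x y z)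

CherryDense : ∀ {n} → ℚ → ℚ → 3Graph n → Set
CherryDense {n} ρ d H =
  ∀ (G₁ G₂ : Fin n → Fin n → Bool) →
    d * ⟦ |P₂| G₁ G₂ ⟧ - ρ * ⟦ n ℕ.^ 3 ⟧ ≤ ⟦ e[ H ] G₁ G₂ ⟧

Absorber : ∀ {n} → 3Graph n → Fin n → Fin n → Fin n → Fin n → Fin n → Set
Absorber H v x y z w =
  (edge H x y z ≡ true) × (edge H y z w ≡ true) × (edge H v x y ≡ true)
  × (edge H v y z ≡ true) × (edge H v z w ≡ true)

module Submission where

-- Consider ordered pairs yz in the link of v with y, z ∉ W, and call such a pair good when its
-- H'-degree is nonzero, hence at least dn/3. If some good xy and some good wz have
-- xyz, wzy ∈ E(H), then (x, y, z, w) is the required absorber. Otherwise yz or zy is stuck: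
-- no good xy extends it to an edge of H. No cherry (x, y, z) with xy good and yz stuck spans an
-- edge, so by cherry-density there are at most ρn³/d of them. For y with at least n/(16K) good
-- pairs these cherries bound the stuck pairs at y; at any other y a stuck pair yz either has
-- zy among those few good pairs or has H'-degree 0, and such pairs are rare. So at most
-- 7n²/(64K) pairs are stuck, whereas δ₁(H) ≥ α C(n,2) and |W| ≤ αn/4 leave about n²/(2K)
-- link pairs outside W (K ≥ 1/α, 1/d).

module Counting where

  open import Defs
  open import Data.Nat using (ℕ; zero; suc; _+_; _*_; _≤_; _<_; z≤n; s≤s; z<s)
  open import Data.Nat.Properties
  open import Data.Nat.ListAction using (sum)
  open import Data.List using (map; tabulate; allFin)
  open import Data.List.Properties using (map-tabulate)
  open import Data.Fin using (Fin; zero; suc)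
  open import Data.Bool using (Bool; true; false; if_then_else_; _∧_; _∨_)
  open import Data.Product using (_,_; ∃-syntax)
  open import Data.Sum using (_⊎_; inj₁; inj₂)
  open import Data.Empty using (⊥)
  open import Function using (_∘_; flip)
  open import Relation.Binary.PropositionalEquality
  open import Algebra.Properties.Semiring.Sum +-*-semiring
    using (sum-cong-≗; ∑-distrib-+; ∑-comm; *-distribˡ-sum; *-distribʳ-sum)
    renaming (sum to ∑)

  ∑-mono-≤ : ∀ {n} {f g : Fin n → ℕ} → (∀ i → f i ≤ g i) → ∑ f ≤ ∑ g
  ∑-mono-≤ {zero}  f≤g = z≤n
  ∑-mono-≤ {suc n} f≤g = +-mono-≤ (f≤g zero) (∑-mono-≤ (f≤g ∘ suc))

  ∑-const : ∀ n k → ∑ {n} (λ _ → k) ≡ n * k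
  ∑-const zero    k = refl
  ∑-const (suc n) k = cong (k +_) (∑-const n k)

  ∑-zero : ∀ {n} {f : Fin n → ℕ} → (∀ i → f i ≡ 0) → ∑ f ≡ 0
  ∑-zero {n} f≗0 = trans (sum-cong-≗ f≗0) (trans (∑-const n 0) (*-zeroʳ n))

  ∑-*ˡ : ∀ {n} k (f : Fin n → ℕ) → ∑ (λ i → k * f i) ≡ k * ∑ f
  ∑-*ˡ k f = sym (*-distribˡ-sum k f)

  f≤∑f : ∀ {n} (f : Fin n → ℕ) i → f i ≤ ∑ f
  f≤∑f f zero    = m≤m+n _ _
  f≤∑f f (suc i) = ≤-trans (f≤∑f (f ∘ suc) i) (m≤n+m _ _)

  ∑>0⇒∃>0 : ∀ {n} (f : Fin n → ℕ) → 0 < ∑ f → ∃[ i ] 0 < f i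
  ∑>0⇒∃>0 {suc n} f ∑f>0 with f zero in f0≡
  ... | suc _ = zero , subst (0 <_) (sym f0≡) z<s
  ... | zero  = let i , f[1+i]>0 = ∑>0⇒∃>0 (f ∘ suc) ∑f>0 in suc i , f[1+i]>0

  sum-tabulate : ∀ {n} (f : Fin n → ℕ) → sum (tabulate f) ≡ ∑ f
  sum-tabulate {zero}  f = refl
  sum-tabulate {suc n} f = cong (f zero +_) (sum-tabulate (f ∘ suc))

  sum-allFin : ∀ {n} (f : Fin n → ℕ) → sum (map f (allFin n)) ≡ ∑ f
  sum-allFin f = trans (cong sum (map-tabulate (λ i → i) f)) (sum-tabulate f)

  ⟪_⟫ : Bool → ℕ
  ⟪ b ⟫ = if b then 1 else 0

  ⟪⟫≡0 : ∀ {p} → p ≢ true → ⟪ p ⟫ ≡ 0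
  ⟪⟫≡0 {false} _ = refl
  ⟪⟫≡0 {true} p≢true with () ← p≢true refl

  ⟪⟫-mono : ∀ {p q} → (p ≡ true → q ≡ true) → ⟪ p ⟫ ≤ ⟪ q ⟫
  ⟪⟫-mono {false} p⇒q = z≤n
  ⟪⟫-mono {true}  p⇒q rewrite p⇒q refl = ≤-refl

  ⟪⟫-∪ : ∀ {p q r} → (p ≡ true → q ≡ true ⊎ r ≡ true) → ⟪ p ⟫ ≤ ⟪ q ⟫ + ⟪ r ⟫
  ⟪⟫-∪ {false} p⇒q∨r = z≤n
  ⟪⟫-∪ {true}  p⇒q∨r with p⇒q∨r refl
  ... | inj₁ q≡true rewrite q≡true = s≤s z≤n
  ... | inj₂ r≡true rewrite r≡true = m≤n+m 1 _

  ⟪⟫-disjoint-∪ : ∀ {p q r} → (q ≡ true → r ≡ true → ⊥) →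
                  (q ≡ true → p ≡ true) → (r ≡ true → p ≡ true) → ⟪ q ⟫ + ⟪ r ⟫ ≤ ⟪ p ⟫
  ⟪⟫-disjoint-∪ {q = false} _ _ r⇒p = ⟪⟫-mono r⇒p
  ⟪⟫-disjoint-∪ {q = true} {false} _ q⇒p _ rewrite q⇒p refl = ≤-refl
  ⟪⟫-disjoint-∪ {q = true} {true} q∩r=∅ _ _ with () ← q∩r=∅ refl refl

  module _ {n : ℕ} where

    count≡∑ : (P : Fin n → Bool) → count P ≡ ∑ (λ i → ⟪ P i ⟫)
    count≡∑ P = sum-allFin {n} _

    count₂≡∑ : (P : Fin n → Fin n → Bool) → count₂ P ≡ ∑ (λ x → count (P x))
    count₂≡∑ P = sum-allFin {n} _

    count₂≡∑∑ : (P : Fin n → Fin n → Bool) → count₂ P ≡ ∑ (λ x → ∑ λ y → ⟪ P x y ⟫)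
    count₂≡∑∑ P = trans (count₂≡∑ P) (sum-cong-≗ (λ x → count≡∑ (P x)))

    count₃≡∑ : (P : Fin n → Fin n → Fin n → Bool) → count₃ P ≡ ∑ (λ x → count₂ (P x))
    count₃≡∑ P = sum-allFin {n} _

    count-mono : {P Q : Fin n → Bool} → (∀ i → P i ≡ true → Q i ≡ true) → count P ≤ count Q
    count-mono {P} {Q} P⊆Q = begin
      count P              ≡⟨ count≡∑ P ⟩
      ∑ (λ i → ⟪ P i ⟫)    ≤⟨ ∑-mono-≤ (λ i → ⟪⟫-mono (P⊆Q i)) ⟩
      ∑ (λ i → ⟪ Q i ⟫)    ≡⟨ count≡∑ Q ⟨
      count Q              ∎
      where open ≤-Reasoning

    count-cong : {P Q : Fin n → Bool} → (∀ i → P i ≡ Q i) → count P ≡ count Q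
    count-cong P≗Q = ≤-antisym (count-mono (λ i Pi → trans (sym (P≗Q i)) Pi))
                               (count-mono (λ i Qi → trans (P≗Q i) Qi))

    count-∪ : {P Q R : Fin n → Bool} → (∀ i → P i ≡ true → Q i ≡ true ⊎ R i ≡ true) →
              count P ≤ count Q + count R
    count-∪ {P} {Q} {R} P⊆Q∪R = begin
      count P                                ≡⟨ count≡∑ P ⟩
      ∑ (λ i → ⟪ P i ⟫)                      ≤⟨ ∑-mono-≤ (λ i → ⟪⟫-∪ (P⊆Q∪R i)) ⟩
      ∑ (λ i → ⟪ Q i ⟫ + ⟪ R i ⟫)            ≡⟨ ∑-distrib-+ (λ i → ⟪ Q i ⟫) (λ i → ⟪ R i ⟫) ⟩
      ∑ (λ i → ⟪ Q i ⟫) + ∑ (λ i → ⟪ R i ⟫)  ≡⟨ cong₂ _+_ (count≡∑ Q) (count≡∑ R) ⟨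
      count Q + count R                      ∎
      where open ≤-Reasoning

    count-empty : {P : Fin n → Bool} → (∀ i → P i ≢ true) → count P ≡ 0
    count-empty {P} P=∅ = trans (count≡∑ P) (∑-zero (λ i → ⟪⟫≡0 (P=∅ i)))

    count-∧ˡ : ∀ b (P : Fin n → Bool) → count (λ i → b ∧ P i) ≡ ⟪ b ⟫ * count P
    count-∧ˡ true  P = sym (+-identityʳ (count P))
    count-∧ˡ false P = count-empty (λ _ ())

    count>0⇒∃ : (P : Fin n → Bool) → 0 < count P → ∃[ i ] P i ≡ true
    count>0⇒∃ P count>0 with ∑>0⇒∃>0 _ (subst (0 <_) (count≡∑ P) count>0)
    ... | i , ⟪Pi⟫>0 with P i in Pi≡
    ...   | true = i , Pi≡
    ...   | false with () ← ⟪Pi⟫>0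

    ∃⇒count>0 : (P : Fin n → Bool) {i : Fin n} → P i ≡ true → 0 < count P
    ∃⇒count>0 P {i} Pi = begin-strict
      0                    <⟨ subst (λ b → 0 < ⟪ b ⟫) (sym Pi) z<s ⟩
      ⟪ P i ⟫              ≤⟨ f≤∑f _ i ⟩
      ∑ (λ j → ⟪ P j ⟫)    ≡⟨ count≡∑ P ⟨
      count P              ∎
      where open ≤-Reasoning

    count₂-∪ : {P Q R : Fin n → Fin n → Bool} →
               (∀ x y → P x y ≡ true → Q x y ≡ true ⊎ R x y ≡ true) →
               count₂ P ≤ count₂ Q + count₂ R
    count₂-∪ {P} {Q} {R} P⊆Q∪R = begin
      count₂ P                                         ≡⟨ count₂≡∑ P ⟩
      ∑ (λ x → count (P x))                            ≤⟨ ∑-mono-≤ (λ x → count-∪ (P⊆Q∪R x)) ⟩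
      ∑ (λ x → count (Q x) + count (R x))              ≡⟨ ∑-distrib-+ (λ x → count (Q x)) (λ x → count (R x)) ⟩
      ∑ (λ x → count (Q x)) + ∑ (λ x → count (R x))    ≡⟨ cong₂ _+_ (count₂≡∑ Q) (count₂≡∑ R) ⟨
      count₂ Q + count₂ R                              ∎
      where open ≤-Reasoning

    count₂-∨ : (P Q : Fin n → Fin n → Bool) → count₂ (λ x y → P x y ∨ Q x y) ≤ count₂ P + count₂ Q
    count₂-∨ P Q = count₂-∪ (λ x y → ∨-elim)
      where
      ∨-elim : ∀ {p q} → p ∨ q ≡ true → p ≡ true ⊎ q ≡ true
      ∨-elim {true}  _ = inj₁ refl
      ∨-elim {false} q = inj₂ q

    count₂-disjoint-∪ : {P Q R : Fin n → Fin n → Bool} →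
                        (∀ x y → Q x y ≡ true → R x y ≡ true → ⊥) →
                        (∀ x y → Q x y ≡ true → P x y ≡ true) →
                        (∀ x y → R x y ≡ true → P x y ≡ true) →
                        count₂ Q + count₂ R ≤ count₂ P
    count₂-disjoint-∪ {P} {Q} {R} Q∩R=∅ Q⊆P R⊆P = begin
      count₂ Q + count₂ R
        ≡⟨ cong₂ _+_ (count₂≡∑∑ Q) (count₂≡∑∑ R) ⟩
      ∑ (λ x → ∑ λ y → ⟪ Q x y ⟫) + ∑ (λ x → ∑ λ y → ⟪ R x y ⟫)
        ≡⟨ ∑-distrib-+ (λ x → ∑ λ y → ⟪ Q x y ⟫) (λ x → ∑ λ y → ⟪ R x y ⟫) ⟨
      ∑ (λ x → ∑ (λ y → ⟪ Q x y ⟫) + ∑ λ y → ⟪ R x y ⟫)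
        ≡⟨ sum-cong-≗ (λ x → ∑-distrib-+ (λ y → ⟪ Q x y ⟫) (λ y → ⟪ R x y ⟫)) ⟨
      ∑ (λ x → ∑ λ y → ⟪ Q x y ⟫ + ⟪ R x y ⟫)
        ≤⟨ ∑-mono-≤ (λ x → ∑-mono-≤ (λ y → ⟪⟫-disjoint-∪ (Q∩R=∅ x y) (Q⊆P x y) (R⊆P x y))) ⟩
      ∑ (λ x → ∑ λ y → ⟪ P x y ⟫)
        ≡⟨ count₂≡∑∑ P ⟨
      count₂ P
        ∎
      where open ≤-Reasoning

    count₂-transpose : (P : Fin n → Fin n → Bool) → count₂ P ≡ count₂ (flip P)
    count₂-transpose P = begin
      count₂ P                        ≡⟨ count₂≡∑∑ P ⟩
      ∑ (λ x → ∑ λ y → ⟪ P x y ⟫)     ≡⟨ ∑-comm (λ x y → ⟪ P x y ⟫) ⟩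
      ∑ (λ y → ∑ λ x → ⟪ P x y ⟫)     ≡⟨ count₂≡∑∑ (flip P) ⟨
      count₂ (flip P)                 ∎
      where open ≡-Reasoning

    count₂-fst : (P : Fin n → Bool) → count₂ (λ x _ → P x) ≡ n * count P
    count₂-fst P = begin
      count₂ {n} (λ x _ → P x)          ≡⟨ count₂≡∑ (λ x _ → P x) ⟩
      ∑ (λ x → count {n} (λ _ → P x))   ≡⟨ sum-cong-≗ (λ x → trans (count≡∑ _) (∑-const n ⟪ P x ⟫)) ⟩
      ∑ (λ x → n * ⟪ P x ⟫)             ≡⟨ ∑-*ˡ n (λ x → ⟪ P x ⟫) ⟩
      n * ∑ (λ x → ⟪ P x ⟫)             ≡⟨ cong (n *_) (count≡∑ P) ⟨
      n * count P                       ∎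
      where open ≡-Reasoning

    count₂-snd : (P : Fin n → Bool) → count₂ (λ _ y → P y) ≡ n * count P
    count₂-snd P = trans (count₂≡∑ (λ _ y → P y)) (∑-const n (count P))

    count₂>0⇒∃ : (P : Fin n → Fin n → Bool) → 0 < count₂ P → ∃[ x ] ∃[ y ] P x y ≡ true
    count₂>0⇒∃ P count₂>0 with ∑>0⇒∃>0 _ (subst (0 <_) (count₂≡∑ P) count₂>0)
    ... | x , countPx>0 = x , count>0⇒∃ (P x) countPx>0

    count₃-empty : {P : Fin n → Fin n → Fin n → Bool} → (∀ x y z → P x y z ≢ true) → count₃ P ≡ 0
    count₃-empty {P} P=∅ = trans (count₃≡∑ P) (∑-zero λ x →
      trans (count₂≡∑ (P x)) (∑-zero λ y → count-empty (P=∅ x y)))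

    |P₂|≡∑ : (G₁ G₂ : Fin n → Fin n → Bool) →
             |P₂| G₁ G₂ ≡ ∑ (λ y → count (λ x → G₁ x y) * count (G₂ y))
    |P₂|≡∑ G₁ G₂ = begin
      |P₂| G₁ G₂
        ≡⟨ count₃≡∑ _ ⟩
      ∑ (λ x → count₂ λ y z → G₁ x y ∧ G₂ y z)
        ≡⟨ sum-cong-≗ (λ x → count₂≡∑ (λ y z → G₁ x y ∧ G₂ y z)) ⟩
      ∑ (λ x → ∑ λ y → count λ z → G₁ x y ∧ G₂ y z)
        ≡⟨ sum-cong-≗ (λ x → sum-cong-≗ (λ y → count-∧ˡ (G₁ x y) (G₂ y))) ⟩
      ∑ (λ x → ∑ λ y → ⟪ G₁ x y ⟫ * count (G₂ y))
        ≡⟨ ∑-comm (λ x y → ⟪ G₁ x y ⟫ * count (G₂ y)) ⟩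
      ∑ (λ y → ∑ λ x → ⟪ G₁ x y ⟫ * count (G₂ y))
        ≡⟨ sum-cong-≗ (λ y → *-distribʳ-sum (count (G₂ y)) (λ x → ⟪ G₁ x y ⟫)) ⟨
      ∑ (λ y → ∑ (λ x → ⟪ G₁ x y ⟫) * count (G₂ y))
        ≡⟨ sum-cong-≗ (λ y → cong (_* count (G₂ y)) (count≡∑ (λ x → G₁ x y))) ⟨
      ∑ (λ y → count (λ x → G₁ x y) * count (G₂ y))
        ∎
      where open ≡-Reasoning

module Arithmetic where

  open import Data.Nat
  open import Data.Nat.Properties
  open import Data.Nat.Combinatorics using (_C_; nC1≡n; nCk+nC[k+1]≡[n+1]C[k+1])
  open import Data.Nat.Tactic.RingSolver using (solve-∀)
  open import Data.Empty using (⊥)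
  open import Data.Sum using (inj₁; inj₂)
  open import Relation.Binary.PropositionalEquality

  nC2+nC2+n≡n*n : ∀ n → n C 2 + n C 2 + n ≡ n * n
  nC2+nC2+n≡n*n zero    = refl
  nC2+nC2+n≡n*n (suc n) = begin
    suc n C 2 + suc n C 2 + suc n                 ≡⟨ cong (λ c → c + c + suc n) [1+n]C2≡n+nC2 ⟩
    (n + n C 2) + (n + n C 2) + suc n             ≡⟨ regroup n (n C 2) ⟩
    (n C 2 + n C 2 + n) + (suc n + n)             ≡⟨ cong (_+ (suc n + n)) (nC2+nC2+n≡n*n n) ⟩
    n * n + (suc n + n)                           ≡⟨ square n ⟩
    suc n * suc n                                 ∎
    where
    open ≡-Reasoning
    [1+n]C2≡n+nC2 : suc n C 2 ≡ n + n C 2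
    [1+n]C2≡n+nC2 = trans (sym (nCk+nC[k+1]≡[n+1]C[k+1] n 1)) (cong (_+ n C 2) (nC1≡n n))
    regroup : ∀ n c → (n + c) + (n + c) + suc n ≡ (c + c + n) + (suc n + n)
    regroup = solve-∀
    square : ∀ n → n * n + (suc n + n) ≡ suc n * suc n
    square = solve-∀

  ^-distribʳ-* : ∀ m n k → (m * n) ^ k ≡ m ^ k * n ^ k
  ^-distribʳ-* m n zero    = refl
  ^-distribʳ-* m n (suc k) = begin
    m * n * (m * n) ^ k          ≡⟨ cong (m * n *_) (^-distribʳ-* m n k) ⟩
    m * n * (m ^ k * n ^ k)      ≡⟨ interchange m n (m ^ k) (n ^ k) ⟩
    m * m ^ k * (n * n ^ k)      ∎
    where
    open ≡-Reasoning
    interchange : ∀ a b c d → a * b * (c * d) ≡ a * c * (b * d)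
    interchange = solve-∀

  ^-root-≤ : ∀ k .{{_ : NonZero k}} {s q c m} → s ^ k ≤ q → q * c ^ k ≤ m ^ k → s * c ≤ m
  ^-root-≤ k {s} {q} {c} {m} sᵏ≤q qcᵏ≤mᵏ = ≮⇒≥ λ m<sc → <⇒≱ (^-monoˡ-< k m<sc) (begin
    (s * c) ^ k     ≡⟨ ^-distribʳ-* s c k ⟩
    s ^ k * c ^ k   ≤⟨ *-monoˡ-≤ (c ^ k) sᵏ≤q ⟩
    q * c ^ k       ≤⟨ qcᵏ≤mᵏ ⟩
    m ^ k           ∎)
    where open ≤-Reasoning

  1024K³≤[32K]⁵ : ∀ K .{{_ : NonZero K}} → 1024 * (K * K * K) ≤ (32 * K) ^ 5
  1024K³≤[32K]⁵ K = begin
    1024 * (K * K * K)                          ≤⟨ m≤m*n (1024 * (K * K * K)) (32768 * (K * K)) ⟩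
    1024 * (K * K * K) * (32768 * (K * K))      ≡⟨ expand K ⟩
    (32 * K) ^ 5                                ∎
    where
    open ≤-Reasoning
    instance _ = m*n≢0 32768 (K * K) {{_}} {{m*n≢0 K K}}
    expand : ∀ K → 1024 * (K * K * K) * (32768 * (K * K)) ≡ 32 * K * (32 * K * (32 * K * (32 * K * (32 * K * 1))))
    expand = solve-∀

  threshold-bound : ∀ a n f s l → s ≤ f + l → a * n * s ≤ a * a * (f * s) + (n * n + a * n * l)
  threshold-bound a n f s l s≤f+l with ≤-total n (a * f)
  ... | inj₁ n≤af = begin
    a * n * s                                   ≤⟨ *-monoˡ-≤ s (*-monoʳ-≤ a n≤af) ⟩
    a * (a * f) * s                             ≡⟨ regroup a f s ⟩
    a * a * (f * s)                             ≤⟨ m≤m+n _ _ ⟩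
    a * a * (f * s) + (n * n + a * n * l)       ∎
    where
    open ≤-Reasoning
    regroup : ∀ a f s → a * (a * f) * s ≡ a * a * (f * s)
    regroup = solve-∀
  ... | inj₂ af≤n = begin
    a * n * s                                   ≡⟨ regroup a n s ⟩
    n * (a * s)                                 ≤⟨ *-monoʳ-≤ n (*-monoʳ-≤ a s≤f+l) ⟩
    n * (a * (f + l))                           ≡⟨ cong (n *_) (*-distribˡ-+ a f l) ⟩
    n * (a * f + a * l)                         ≤⟨ *-monoʳ-≤ n (+-monoˡ-≤ (a * l) af≤n) ⟩
    n * (n + a * l)                             ≡⟨ expand a n l ⟩
    n * n + a * n * l                           ≤⟨ m≤n+m _ (a * a * (f * s)) ⟩
    a * a * (f * s) + (n * n + a * n * l)       ∎
    where
    open ≤-Reasoning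
    regroup : ∀ a n s → a * n * s ≡ n * (a * s)
    regroup = solve-∀
    expand : ∀ a n l → n * (n + a * l) ≡ n * n + a * n * l
    expand = solve-∀

  link-lower-bound : ∀ {K n C D L O w} → C + C + n ≡ n * n → C ≤ K * D → D + D ≤ L →
                     L ≤ O + (n * w + n * w) → 4 * (n * w) ≤ D + D + n → n * n ≤ K * (O + O + n) + n
  link-lower-bound {K} {n} {C} {D} {L} {O} {w} 2C+n≡n² C≤KD 2D≤L L≤O+2nw 4nw≤2D+n = begin
    n * n                ≡⟨ 2C+n≡n² ⟨
    C + C + n            ≤⟨ +-monoˡ-≤ n (+-mono-≤ C≤KD C≤KD) ⟩
    K * D + K * D + n    ≡⟨ cong (_+ n) (*-distribˡ-+ K D D) ⟨
    K * (D + D) + n      ≤⟨ +-monoˡ-≤ n (*-monoʳ-≤ K 2D≤2O+n) ⟩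
    K * (O + O + n) + n  ∎
    where
    open ≤-Reasoning
    2D≤2O+n : D + D ≤ O + O + n
    2D≤2O+n = +-cancelˡ-≤ (D + D) _ _ (begin
      (D + D) + (D + D)               ≤⟨ +-mono-≤ 2D≤L 2D≤L ⟩
      L + L                           ≤⟨ +-mono-≤ L≤O+2nw L≤O+2nw ⟩
      (O + (n * w + n * w)) + (O + (n * w + n * w))
                                      ≡⟨ regroup O n w ⟩
      O + O + 4 * (n * w)             ≤⟨ +-monoʳ-≤ (O + O) 4nw≤2D+n ⟩
      O + O + (D + D + n)             ≡⟨ swap (O + O) (D + D) n ⟩
      (D + D) + (O + O + n)           ∎)
      where
      regroup : ∀ O n w → (O + (n * w + n * w)) + (O + (n * w + n * w)) ≡ O + O + 4 * (n * w)
      regroup = solve-∀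
      swap : ∀ a b c → a + (b + c) ≡ b + (a + c)
      swap = solve-∀

  cherry-term-bound : ∀ K .{{_ : NonZero K}} {q P n} → 1024 * (K * K * K) ≤ q → q * P ≤ K * n ^ 3 →
                      4 * (16 * K * (16 * K) * P) ≤ n * (n * n)
  cherry-term-bound K {q} {P} {n} 1024K³≤q qP≤Kn³ = *-cancelˡ-≤ K (begin
    K * (4 * (16 * K * (16 * K) * P))   ≡⟨ regroup K P ⟩
    1024 * (K * K * K) * P              ≤⟨ *-monoˡ-≤ P 1024K³≤q ⟩
    q * P                               ≤⟨ qP≤Kn³ ⟩
    K * n ^ 3                           ≡⟨ cong (K *_) (cube n) ⟩
    K * (n * (n * n))                   ∎)
    where
    open ≤-Reasoning
    regroup : ∀ K P → K * (4 * (16 * K * (16 * K) * P)) ≡ 1024 * (K * K * K) * P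
    regroup = solve-∀
    cube : ∀ n → n * (n * (n * 1)) ≡ n * (n * n)
    cube = solve-∀

  light-term-bound : ∀ K {l c C n} → l ≤ c + c → 32 * K * c ≤ C → C + C + n ≡ n * n →
                     2 * (16 * K * l) ≤ n * n
  light-term-bound K {l} {c} {C} {n} l≤2c 32Kc≤C 2C+n≡n² = begin
    2 * (16 * K * l)             ≤⟨ *-monoʳ-≤ 2 (*-monoʳ-≤ (16 * K) l≤2c) ⟩
    2 * (16 * K * (c + c))       ≡⟨ regroup K c ⟩
    32 * K * c + 32 * K * c      ≤⟨ +-mono-≤ 32Kc≤C 32Kc≤C ⟩
    C + C                        ≤⟨ m≤m+n (C + C) n ⟩
    C + C + n                    ≡⟨ 2C+n≡n² ⟩
    n * n                        ∎
    where
    open ≤-Reasoning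
    regroup : ∀ K c → 2 * (16 * K * (c + c)) ≡ 32 * K * c + 32 * K * c
    regroup = solve-∀

  stuck-bound : ∀ {a n P S l} .{{_ : NonZero n}} → 4 * (a * a * P) ≤ n * (n * n) → 2 * (a * l) ≤ n * n →
                a * n * S ≤ a * a * P + (n * (n * n) + a * n * l) → 4 * (a * S) ≤ 7 * (n * n)
  stuck-bound {a} {n} {P} {S} {l} 4a²P≤n³ 2al≤n² anS≤ = *-cancelˡ-≤ n (begin
    n * (4 * (a * S))                                          ≡⟨ regroupˡ a n S ⟩
    4 * (a * n * S)                                            ≤⟨ *-monoʳ-≤ 4 anS≤ ⟩
    4 * (a * a * P + (n * (n * n) + a * n * l))                ≡⟨ regroupʳ a n P l ⟩
    4 * (a * a * P) + (4 * (n * (n * n)) + 2 * n * (2 * (a * l)))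
      ≤⟨ +-mono-≤ 4a²P≤n³ (+-monoʳ-≤ (4 * (n * (n * n))) (*-monoʳ-≤ (2 * n) 2al≤n²)) ⟩
    n * (n * n) + (4 * (n * (n * n)) + 2 * n * (n * n))       ≡⟨ collect n ⟩
    n * (7 * (n * n))                                          ∎)
    where
    open ≤-Reasoning
    regroupˡ : ∀ a n S → n * (4 * (a * S)) ≡ 4 * (a * n * S)
    regroupˡ = solve-∀
    regroupʳ : ∀ a n P l → 4 * (a * a * P + (n * (n * n) + a * n * l)) ≡
                           4 * (a * a * P) + (4 * (n * (n * n)) + 2 * n * (2 * (a * l)))
    regroupʳ = solve-∀
    collect : ∀ n → n * (n * n) + (4 * (n * (n * n)) + 2 * n * (n * n)) ≡ n * (7 * (n * n))
    collect = solve-∀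

  link-bounds-incompatible : ∀ K {n O S} → O ≤ S + S → n * n ≤ K * (O + O + n) + n →
                             4 * (16 * K * S) ≤ 7 * (n * n) → 2 * K + 2 ≤ n → ⊥
  link-bounds-incompatible K {n} {O} {S} O≤2S n²≤ 64KS≤7n² 2K+2≤n = <⇒≱ 16[K+1]<9n 9n≤16[K+1]
    where
    open ≤-Reasoning
    instance _ = >-nonZero (≤-trans (s≤s z≤n) (≤-trans (m≤n+m 2 (2 * K)) 2K+2≤n))
    16[K+1]<9n : 16 * (K + 1) < 9 * n
    16[K+1]<9n = begin-strict
      16 * (K + 1)                  <⟨ m<m+n (16 * (K + 1)) (s≤s z≤n) ⟩
      16 * (K + 1) + suc (2 * K + 1) ≡⟨ regroup K ⟩
      9 * (2 * K + 2)               ≤⟨ *-monoʳ-≤ 9 2K+2≤n ⟩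
      9 * n                         ∎
      where
      regroup : ∀ K → 16 * (K + 1) + suc (2 * K + 1) ≡ 9 * (2 * K + 2)
      regroup = solve-∀
    9n≤16[K+1] : 9 * n ≤ 16 * (K + 1)
    9n≤16[K+1] = *-cancelˡ-≤ n (+-cancelˡ-≤ (7 * (n * n)) _ _ (begin
      7 * (n * n) + n * (9 * n)                  ≡⟨ split n ⟩
      16 * (n * n)                               ≤⟨ *-monoʳ-≤ 16 n²≤ ⟩
      16 * (K * (O + O + n) + n)                 ≤⟨ *-monoʳ-≤ 16 (+-monoˡ-≤ n (*-monoʳ-≤ K O+O+n≤4S+n)) ⟩
      16 * (K * ((S + S) + (S + S) + n) + n)     ≡⟨ regroup K S n ⟩
      4 * (16 * K * S) + n * (16 * (K + 1))      ≤⟨ +-monoˡ-≤ (n * (16 * (K + 1))) 64KS≤7n² ⟩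
      7 * (n * n) + n * (16 * (K + 1))           ∎))
      where
      O+O+n≤4S+n = +-monoˡ-≤ n (+-mono-≤ O≤2S O≤2S)
      split : ∀ n → 7 * (n * n) + n * (9 * n) ≡ 16 * (n * n)
      split = solve-∀
      regroup : ∀ K S n → 16 * (K * ((S + S) + (S + S) + n) + n) ≡ 4 * (16 * K * S) + n * (16 * (K + 1))
      regroup = solve-∀

module Rationals where

  open import Defs
  open Arithmetic using (^-root-≤)
  open import Data.Nat as ℕ using (ℕ; zero; suc)
  import Data.Nat.Properties as ℕ
  open import Data.Integer as ℤ using (+_; +[1+_]; -[1+_])
  import Data.Integer.Properties as ℤ
  open import Data.Rational using (ℚ; mkℚ; 0ℚ; 1ℚ; _<_; _≤_; _*_; _/_; _+_; _-_; NonNegative; nonNegative; *≤*; *<*)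
  open import Data.Rational.Properties
  open import Data.Rational.Solver using (module +-*-Solver)
  open import Data.Nat.Coprimality using (1-coprimeTo) renaming (sym to coprime-sym)
  open import Data.Product using (_,_; ∃-syntax)
  open import Data.Fin using (Fin)
  open import Data.Bool using (Bool)
  open import Relation.Binary.PropositionalEquality

  open +-*-Solver using (solve; _:+_; _:*_; _:-_; _:=_)

  ⟦⟧≡mkℚ : ∀ n → ⟦ n ⟧ ≡ mkℚ (+ n) 0 (coprime-sym (1-coprimeTo n))
  ⟦⟧≡mkℚ n = normalize-coprime (coprime-sym (1-coprimeTo n))

  ⟦⟧-cancel-≤ : ∀ {m n} → ⟦ m ⟧ ≤ ⟦ n ⟧ → m ℕ.≤ n
  ⟦⟧-cancel-≤ {m} {n} ⟦m⟧≤⟦n⟧ rewrite ⟦⟧≡mkℚ m | ⟦⟧≡mkℚ n with ⟦m⟧≤⟦n⟧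
  ... | *≤* m*1≤n*1 = ℤ.drop‿+≤+ (subst₂ ℤ._≤_ (ℤ.*-identityʳ (+ m)) (ℤ.*-identityʳ (+ n)) m*1≤n*1)

  ⟦⟧-mono-≤ : ∀ {m n} → m ℕ.≤ n → ⟦ m ⟧ ≤ ⟦ n ⟧
  ⟦⟧-mono-≤ {m} {n} m≤n rewrite ⟦⟧≡mkℚ m | ⟦⟧≡mkℚ n =
    *≤* (subst₂ ℤ._≤_ (sym (ℤ.*-identityʳ (+ m))) (sym (ℤ.*-identityʳ (+ n))) (ℤ.+≤+ m≤n))

  ⟦⟧-* : ∀ m n → ⟦ m ℕ.* n ⟧ ≡ ⟦ m ⟧ * ⟦ n ⟧
  ⟦⟧-* m n rewrite ⟦⟧≡mkℚ m | ⟦⟧≡mkℚ n = /-cong (ℤ.pos-* m n) refl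

  ⟦⟧-+ : ∀ m n → ⟦ m ℕ.+ n ⟧ ≡ ⟦ m ⟧ + ⟦ n ⟧
  ⟦⟧-+ m n rewrite ⟦⟧≡mkℚ m | ⟦⟧≡mkℚ n =
    /-cong (trans (ℤ.pos-+ m n) (sym (cong₂ ℤ._+_ (ℤ.*-identityʳ (+ m)) (ℤ.*-identityʳ (+ n))))) refl

  ⟦⟧-nonNeg : ∀ n → NonNegative ⟦ n ⟧
  ⟦⟧-nonNeg n = normalize-nonNeg n 1

  ⟦⟧*-mono-≤ : ∀ n {x y} → x ≤ y → ⟦ n ⟧ * x ≤ ⟦ n ⟧ * y
  ⟦⟧*-mono-≤ n = *-monoˡ-≤-nonNeg ⟦ n ⟧ {{⟦⟧-nonNeg n}}

  *⟦⟧-mono-≤ : ∀ n {x y} → x ≤ y → x * ⟦ n ⟧ ≤ y * ⟦ n ⟧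
  *⟦⟧-mono-≤ n = *-monoʳ-≤-nonNeg ⟦ n ⟧ {{⟦⟧-nonNeg n}}

  ⟦1+t⟧*1/1+t≡1 : ∀ t → ⟦ suc t ⟧ * (+ 1 / suc t) ≡ 1ℚ
  ⟦1+t⟧*1/1+t≡1 t rewrite ⟦⟧≡mkℚ (suc t) | normalize-coprime {1} {t} (1-coprimeTo (suc t)) =
    *-inverseʳ (mkℚ (+ suc t) 0 (coprime-sym (1-coprimeTo (suc t))))

  archimedean : ∀ α → 0ℚ < α → ∃[ k ] 1ℚ ≤ ⟦ suc k ⟧ * α
  archimedean α@(mkℚ +[1+ p ] q _) _ = q , (begin
    1ℚ                                              ≡⟨ ⟦1+t⟧*1/1+t≡1 q ⟨
    ⟦ suc q ⟧ * (+ 1 / suc q)                       ≡⟨ cong (⟦ suc q ⟧ *_) 1/1+q≡mkℚ ⟩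
    ⟦ suc q ⟧ * mkℚ (+ 1) q (1-coprimeTo (suc q))   ≤⟨ ⟦⟧*-mono-≤ (suc q) 1/1+q≤α ⟩
    ⟦ suc q ⟧ * α                                   ∎)
    where
    open ≤-Reasoning
    1/1+q≡mkℚ : + 1 / suc q ≡ mkℚ (+ 1) q (1-coprimeTo (suc q))
    1/1+q≡mkℚ = normalize-coprime (1-coprimeTo (suc q))
    1/1+q≤α : mkℚ (+ 1) q (1-coprimeTo (suc q)) ≤ α
    1/1+q≤α = *≤* (ℤ.*-monoʳ-≤-nonNeg (+ suc q) {+ 1} {+[1+ p ]} (ℤ.+≤+ (ℕ.s≤s ℕ.z≤n)))
  archimedean (mkℚ (+ 0) _ _) (*<* (ℤ.+<+ ()))
  archimedean (mkℚ -[1+ _ ] _ _) (*<* ())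

  p-q≤0⇒p≤q : ∀ {p q} → p - q ≤ 0ℚ → p ≤ q
  p-q≤0⇒p≤q {p} {q} p-q≤0 = begin
    p              ≡⟨ solve 2 (λ p q → p := (p :- q) :+ q) refl p q ⟩
    (p - q) + q    ≤⟨ +-monoˡ-≤ q p-q≤0 ⟩
    0ℚ + q         ≡⟨ +-identityˡ q ⟩
    q              ∎
    where open ≤-Reasoning

  clear-coefficient : ∀ {α K m m'} → 1ℚ ≤ ⟦ K ⟧ * α → α * ⟦ m ⟧ ≤ ⟦ m' ⟧ → m ℕ.≤ K ℕ.* m'
  clear-coefficient {α} {K} {m} {m'} 1≤Kα αm≤m' = ⟦⟧-cancel-≤ (begin
    ⟦ m ⟧                ≡⟨ *-identityˡ ⟦ m ⟧ ⟨
    1ℚ * ⟦ m ⟧           ≤⟨ *⟦⟧-mono-≤ m 1≤Kα ⟩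
    ⟦ K ⟧ * α * ⟦ m ⟧    ≡⟨ *-assoc ⟦ K ⟧ α ⟦ m ⟧ ⟩
    ⟦ K ⟧ * (α * ⟦ m ⟧)  ≤⟨ ⟦⟧*-mono-≤ K αm≤m' ⟩
    ⟦ K ⟧ * ⟦ m' ⟧       ≡⟨ ⟦⟧-* K m' ⟨
    ⟦ K ℕ.* m' ⟧         ∎)
    where open ≤-Reasoning

  clear-reciprocal : ∀ t {x y} → x ≤ (+ 1 / suc t) * y → ⟦ suc t ⟧ * x ≤ y
  clear-reciprocal t {x} {y} x≤y/q = begin
    ⟦ suc t ⟧ * x                   ≤⟨ ⟦⟧*-mono-≤ (suc t) x≤y/q ⟩
    ⟦ suc t ⟧ * (+ 1 / suc t * y)   ≡⟨ *-assoc ⟦ suc t ⟧ (+ 1 / suc t) y ⟨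
    ⟦ suc t ⟧ * (+ 1 / suc t) * y   ≡⟨ cong (_* y) (⟦1+t⟧*1/1+t≡1 t) ⟩
    1ℚ * y                          ≡⟨ *-identityˡ y ⟩
    y                               ∎
    where open ≤-Reasoning

  4nw≤2D+n : ∀ {α n C D w} → α ≤ 1ℚ → C ℕ.+ C ℕ.+ n ≡ n ℕ.* n → α * ⟦ C ⟧ ≤ ⟦ D ⟧ →
             ⟦ w ⟧ ≤ α * ⟦ n ⟧ * (+ 1 / 4) → 4 ℕ.* (n ℕ.* w) ℕ.≤ D ℕ.+ D ℕ.+ n
  4nw≤2D+n {α} {n} {C} {D} {w} α≤1 2C+n≡n² αC≤D w≤αn/4 = ⟦⟧-cancel-≤ (begin
    ⟦ 4 ℕ.* (n ℕ.* w) ⟧                  ≡⟨ trans (⟦⟧-* 4 (n ℕ.* w)) (cong (⟦ 4 ⟧ *_) (⟦⟧-* n w)) ⟩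
    ⟦ 4 ⟧ * (⟦ n ⟧ * ⟦ w ⟧)              ≤⟨ ⟦⟧*-mono-≤ 4 (⟦⟧*-mono-≤ n w≤αn/4) ⟩
    ⟦ 4 ⟧ * (⟦ n ⟧ * (α * ⟦ n ⟧ * ¼))    ≡⟨ regroup ⟦ 4 ⟧ ⟦ n ⟧ α ¼ ⟩
    (⟦ 4 ⟧ * ¼) * (α * (⟦ n ⟧ * ⟦ n ⟧))  ≡⟨ *-identityˡ (α * (⟦ n ⟧ * ⟦ n ⟧)) ⟩
    α * (⟦ n ⟧ * ⟦ n ⟧)                  ≡⟨ cong (α *_) n²≡2C+n ⟩
    α * (⟦ C ⟧ + ⟦ C ⟧ + ⟦ n ⟧)          ≡⟨ distribute α ⟦ C ⟧ ⟦ n ⟧ ⟩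
    α * ⟦ C ⟧ + α * ⟦ C ⟧ + α * ⟦ n ⟧    ≤⟨ +-mono-≤ (+-mono-≤ αC≤D αC≤D) (*⟦⟧-mono-≤ n α≤1) ⟩
    ⟦ D ⟧ + ⟦ D ⟧ + 1ℚ * ⟦ n ⟧           ≡⟨ cong (_+_ (⟦ D ⟧ + ⟦ D ⟧)) (*-identityˡ ⟦ n ⟧) ⟩
    ⟦ D ⟧ + ⟦ D ⟧ + ⟦ n ⟧                ≡⟨ trans (⟦⟧-+ (D ℕ.+ D) n) (cong (_+ ⟦ n ⟧) (⟦⟧-+ D D)) ⟨
    ⟦ D ℕ.+ D ℕ.+ n ⟧                    ∎)
    where
    open ≤-Reasoning
    ¼ = + 1 / 4
    regroup : ∀ f n a q → f * (n * (a * n * q)) ≡ (f * q) * (a * (n * n))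
    regroup = solve 4 (λ f n a q → f :* (n :* (a :* n :* q)) := (f :* q) :* (a :* (n :* n))) refl
    distribute : ∀ a c n → a * (c + c + n) ≡ a * c + a * c + a * n
    distribute = solve 3 (λ a c n → a :* (c :+ c :+ n) := a :* c :+ a :* c :+ a :* n) refl
    n²≡2C+n : ⟦ n ⟧ * ⟦ n ⟧ ≡ ⟦ C ⟧ + ⟦ C ⟧ + ⟦ n ⟧
    n²≡2C+n = begin-equality
      ⟦ n ⟧ * ⟦ n ⟧            ≡⟨ ⟦⟧-* n n ⟨
      ⟦ n ℕ.* n ⟧              ≡⟨ cong ⟦_⟧ 2C+n≡n² ⟨
      ⟦ C ℕ.+ C ℕ.+ n ⟧        ≡⟨ trans (⟦⟧-+ (C ℕ.+ C) n) (cong (_+ ⟦ n ⟧) (⟦⟧-+ C C)) ⟩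
      ⟦ C ⟧ + ⟦ C ⟧ + ⟦ n ⟧    ∎

  cherryDense⇒|P₂|≤ : ∀ {n d K t} {H : 3Graph n} (G₁ G₂ : Fin n → Fin n → Bool) →
                 CherryDense (+ 1 / suc t) d H → 1ℚ ≤ ⟦ K ⟧ * d → e[ H ] G₁ G₂ ≡ 0 →
                 suc t ℕ.* |P₂| G₁ G₂ ℕ.≤ K ℕ.* n ℕ.^ 3
  cherryDense⇒|P₂|≤ {n} {d} {K} {t} {H} G₁ G₂ cherryDense 1≤Kd e≡0 =
    clear-coefficient {d} {K} {suc t ℕ.* P} {n ℕ.^ 3} 1≤Kd (begin
    d * ⟦ suc t ℕ.* P ⟧           ≡⟨ cong (d *_) (⟦⟧-* (suc t) P) ⟩
    d * (⟦ suc t ⟧ * ⟦ P ⟧)       ≡⟨ *-comm-middle d ⟦ suc t ⟧ ⟦ P ⟧ ⟩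
    ⟦ suc t ⟧ * (d * ⟦ P ⟧)       ≤⟨ clear-reciprocal t (p-q≤0⇒p≤q dP-ρn³≤0) ⟩
    ⟦ n ℕ.^ 3 ⟧                   ∎)
    where
    open ≤-Reasoning
    P = |P₂| G₁ G₂
    *-comm-middle : ∀ d q p → d * (q * p) ≡ q * (d * p)
    *-comm-middle = solve 3 (λ d q p → d :* (q :* p) := q :* (d :* p)) refl
    dP-ρn³≤0 : d * ⟦ P ⟧ - (+ 1 / suc t) * ⟦ n ℕ.^ 3 ⟧ ≤ 0ℚ
    dP-ρn³≤0 = subst (λ e → d * ⟦ P ⟧ - (+ 1 / suc t) * ⟦ n ℕ.^ 3 ⟧ ≤ ⟦ e ⟧) e≡0 (cherryDense G₁ G₂)

  root-bound : ∀ k .{{_ : ℕ.NonZero k}} {s t c m} → s ℕ.^ k ℕ.≤ suc t →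
               ⟦ c ℕ.^ k ⟧ ≤ (+ 1 / suc t) * ⟦ m ℕ.^ k ⟧ → s ℕ.* c ℕ.≤ m
  root-bound k {s} {t} {c} {m} sᵏ≤q cᵏ≤mᵏ/q = ^-root-≤ k sᵏ≤q (⟦⟧-cancel-≤ (begin
    ⟦ suc t ℕ.* c ℕ.^ k ⟧          ≡⟨ ⟦⟧-* (suc t) (c ℕ.^ k) ⟩
    ⟦ suc t ⟧ * ⟦ c ℕ.^ k ⟧        ≤⟨ clear-reciprocal t cᵏ≤mᵏ/q ⟩
    ⟦ m ℕ.^ k ⟧                    ∎))
    where open ≤-Reasoning

  archimedean-mono : ∀ {α k K} → 0ℚ < α → k ℕ.≤ K → 1ℚ ≤ ⟦ k ⟧ * α → 1ℚ ≤ ⟦ K ⟧ * α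
  archimedean-mono {α} 0<α k≤K 1≤kα =
    ≤-trans 1≤kα (*-monoʳ-≤-nonNeg α {{nonNegative (<⇒≤ 0<α)}} (⟦⟧-mono-≤ k≤K))

module Absorbers where

  open import Defs
  open Counting
  open Arithmetic
  open import Data.Nat as ℕ using (ℕ; suc; _+_; _*_; _^_; _≤_; _<_; _≡ᵇ_; _<ᵇ_; NonZero; >-nonZero)
  open import Data.Nat.Combinatorics using (_C_)
  open import Data.Nat.Properties
    using (<-cmp; <-asym; <ᵇ⇒<; <⇒<ᵇ; +-monoʳ-≤; ≤-trans; m≤n+m; n≢0⇒n>0; +-*-semiring; module ≤-Reasoning)
  open import Data.Rational as ℚ using (ℚ)
  open import Data.Fin using (Fin; toℕ)
  open import Data.Fin.Properties using (toℕ-injective)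
  open import Data.Bool using (Bool; true; false; not; _∧_; _∨_)
  open import Data.Bool.Properties using (∧-comm; not-injective; T-≡)
  open import Data.Product using (_×_; _,_; ∃-syntax; proj₁; proj₂)
  open import Data.Sum using (_⊎_; inj₁; inj₂; map₁; [_,_]′)
  open import Data.Empty using (⊥; ⊥-elim)
  open import Function using (id; flip; _∘_)
  open import Function.Bundles using (Equivalence)
  open import Relation.Binary.Definitions using (tri<; tri≈; tri>)
  open import Relation.Binary.PropositionalEquality
  open import Algebra.Properties.Semiring.Sum +-*-semiring using (∑-distrib-+) renaming (sum to ∑)

  deg₂-sym : ∀ {n} (G : 3Graph n) x y → deg₂ G x y ≡ deg₂ G y x
  deg₂-sym G x y = count-cong (sym₁₂ G x y)

  DegreeDichotomy : ∀ {n} → 3Graph n → ℚ → Set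
  DegreeDichotomy G b = ∀ x y → toℕ x < toℕ y → (b ℚ.≤ ⟦ deg₂ G x y ⟧) ⊎ (deg₂ G x y ≡ 0)

  dichotomy⇒large : ∀ {n} {G : 3Graph n} {b} → DegreeDichotomy G b →
                    ∀ {x y} → x ≢ y → deg₂ G x y ≢ 0 → b ℚ.≤ ⟦ deg₂ G x y ⟧
  dichotomy⇒large {G = G} {b} dichotomy {x} {y} x≢y deg≢0 with <-cmp (toℕ x) (toℕ y)
  ... | tri< x<y _ _ = [ id , ⊥-elim ∘ deg≢0 ]′ (dichotomy x y x<y)
  ... | tri≈ _ x≡y _ = ⊥-elim (x≢y (toℕ-injective x≡y))
  ... | tri> _ _ y<x = [ subst (λ k → b ℚ.≤ ⟦ k ⟧) (deg₂-sym G y x)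
                       , ⊥-elim ∘ deg≢0 ∘ trans (deg₂-sym G x y)
                       ]′ (dichotomy y x y<x)

  ∧-elim : ∀ {a b} → a ∧ b ≡ true → a ≡ true × b ≡ true
  ∧-elim {true} b≡true = refl , b≡true

  ∧-elim₃ : ∀ {a b c} → a ∧ b ∧ c ≡ true → a ≡ true × b ≡ true × c ≡ true
  ∧-elim₃ abc = let a , bc = ∧-elim abc in a , ∧-elim bc

  <ᵇ≡true⇒< : ∀ {m n} → (m <ᵇ n) ≡ true → m < n
  <ᵇ≡true⇒< {m} {n} m<ᵇn = <ᵇ⇒< m n (Equivalence.from T-≡ m<ᵇn)

  <⇒<ᵇ≡true : ∀ {m n} → m < n → (m <ᵇ n) ≡ true
  <⇒<ᵇ≡true m<n = Equivalence.to T-≡ (<⇒<ᵇ m<n)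

  ≡ᵇ0≡false⇒≢0 : ∀ {m} → (m ≡ᵇ 0) ≡ false → m ≢ 0
  ≡ᵇ0≡false⇒≢0 {suc m} _ ()

  module Link {n : ℕ} (H H' : 3Graph n) (v : Fin n) (W : Fin n → Bool) where

    link : Fin n → Fin n → Bool
    link = edge H v

    outerLink : Fin n → Fin n → Bool
    outerLink y z = link y z ∧ (not (W y) ∧ not (W z))

    unsupported : Fin n → Fin n → Bool
    unsupported y z = deg₂ H' y z ≡ᵇ 0

    good : Fin n → Fin n → Bool
    good y z = outerLink y z ∧ not (unsupported y z)

    light : Fin n → Fin n → Bool
    light y z = outerLink y z ∧ unsupported y z

    extendable : Fin n → Fin n → Bool
    extendable y z = 0 <ᵇ count (λ x → good x y ∧ edge H x y z)

    stuck : Fin n → Fin n → Bool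
    stuck y z = outerLink y z ∧ not (extendable y z)

    absorbing : Fin n → Fin n → Bool
    absorbing y z = outerLink y z ∧ (extendable y z ∧ extendable z y)

    link-sym : ∀ y z → link y z ≡ link z y
    link-sym = sym₂₃ H v

    outerLink-sym : ∀ y z → outerLink y z ≡ outerLink z y
    outerLink-sym y z = cong₂ _∧_ (link-sym y z) (∧-comm (not (W y)) (not (W z)))

    unsupported-sym : ∀ y z → unsupported y z ≡ unsupported z y
    unsupported-sym y z = cong (_≡ᵇ 0) (deg₂-sym H' y z)

    good-sym : ∀ y z → good y z ≡ good z y
    good-sym y z = cong₂ _∧_ (outerLink-sym y z) (cong not (unsupported-sym y z))

    outerLink-elim : ∀ {y z} → outerLink y z ≡ true → link y z ≡ true × W y ≡ false × W z ≡ false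
    outerLink-elim outer with ∧-elim outer
    ... | linked , free with ∧-elim free
    ...   | free-y , free-z = linked , not-injective free-y , not-injective free-z

    link-distinct : ∀ {y z} → link y z ≡ true → y ≢ z
    link-distinct {y} {z} linked = proj₁ (proj₂ (distinct H v y z linked))

    extendable-intro : ∀ {x y z} → good x y ≡ true → edge H x y z ≡ true → extendable y z ≡ true
    extendable-intro {x} {y} {z} good-xy xyz =
      <⇒<ᵇ≡true (∃⇒count>0 (λ x′ → good x′ y ∧ edge H x′ y z) (cong₂ _∧_ good-xy xyz))

    extendable-elim : ∀ {y z} → extendable y z ≡ true → ∃[ x ] (good x y ≡ true × edge H x y z ≡ true)
    extendable-elim {y} {z} ext with count>0⇒∃ (λ x → good x y ∧ edge H x y z) (<ᵇ≡true⇒< ext)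
    ... | x , witness = x , ∧-elim witness

    deg₁+deg₁≤|link| : deg₁ H v + deg₁ H v ≤ count₂ link
    deg₁+deg₁≤|link| = begin
      count₂ ordered + count₂ ordered          ≡⟨ cong (count₂ ordered +_) (count₂-transpose ordered) ⟩
      count₂ ordered + count₂ (flip ordered)   ≤⟨ count₂-disjoint-∪ disjoint (λ y z → proj₂ ∘ ∧-elim)
                                                    (λ y z → trans (link-sym y z) ∘ proj₂ ∘ ∧-elim) ⟩
      count₂ link                              ∎
      where
      open ≤-Reasoning
      ordered : Fin n → Fin n → Bool
      ordered y z = (toℕ y <ᵇ toℕ z) ∧ link y z
      disjoint : ∀ y z → ordered y z ≡ true → ordered z y ≡ true → ⊥
      disjoint y z yz zy =
        <-asym (<ᵇ≡true⇒< {toℕ y} (proj₁ (∧-elim yz))) (<ᵇ≡true⇒< {toℕ z} (proj₁ (∧-elim zy)))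

    |link|≤|outerLink|+2n|W| : count₂ link ≤ count₂ outerLink + (n * count W + n * count W)
    |link|≤|outerLink|+2n|W| = begin
      count₂ link
        ≤⟨ count₂-∪ (λ y z → inside-or-touching-W (W y) (W z)) ⟩
      count₂ outerLink + count₂ (λ y z → W y ∨ W z)
        ≤⟨ +-monoʳ-≤ (count₂ outerLink) (count₂-∨ (λ y _ → W y) (λ _ z → W z)) ⟩
      count₂ outerLink + (count₂ (λ y _ → W y) + count₂ (λ _ z → W z))
        ≡⟨ cong (count₂ outerLink +_) (cong₂ _+_ (count₂-fst W) (count₂-snd W)) ⟩
      count₂ outerLink + (n * count W + n * count W)
        ∎
      where
      open ≤-Reasoning
      inside-or-touching-W : ∀ {l} a b → l ≡ true → l ∧ (not a ∧ not b) ≡ true ⊎ (a ∨ b) ≡ true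
      inside-or-touching-W false false l≡true = inj₁ (cong (_∧ true) l≡true)
      inside-or-touching-W false true  _      = inj₂ refl
      inside-or-touching-W true  _     _      = inj₂ refl

    |outerLink|≤|absorbing|+2|stuck| : count₂ outerLink ≤ count₂ absorbing + (count₂ stuck + count₂ stuck)
    |outerLink|≤|absorbing|+2|stuck| = begin
      count₂ outerLink
        ≤⟨ count₂-∪ {Q = absorbing} (λ y z → absorbing-or-stuck) ⟩
      count₂ absorbing + count₂ (λ y z → stuck y z ∨ stuck z y)
        ≤⟨ +-monoʳ-≤ (count₂ absorbing) (count₂-∨ stuck (flip stuck)) ⟩
      count₂ absorbing + (count₂ stuck + count₂ (flip stuck))
        ≡⟨ cong (λ s → count₂ absorbing + (count₂ stuck + s)) (count₂-transpose stuck) ⟨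
      count₂ absorbing + (count₂ stuck + count₂ stuck)
        ∎
      where
      open ≤-Reasoning
      absorbing-or-stuck : ∀ {y z} → outerLink y z ≡ true →
                           absorbing y z ≡ true ⊎ (stuck y z ∨ stuck z y) ≡ true
      absorbing-or-stuck {y} {z} outer =
        cover (extendable y z) (extendable z y) outer (trans (outerLink-sym z y) outer)
        where
        cover : ∀ {o o′} e₁ e₂ → o ≡ true → o′ ≡ true →
                o ∧ (e₁ ∧ e₂) ≡ true ⊎ (o ∧ not e₁ ∨ o′ ∧ not e₂) ≡ true
        cover true  true  refl refl = inj₁ refl
        cover true  false refl refl = inj₂ refl
        cover false _     refl refl = inj₂ refl

    |stuck|≤|good|+|light| : ∀ y → count (stuck y) ≤ count (λ x → good x y) + count (light y)
    |stuck|≤|good|+|light| y = count-∪ good-or-light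
      where
      split : ∀ {o} u → o ≡ true → o ∧ not u ≡ true ⊎ o ∧ u ≡ true
      split false refl = inj₁ refl
      split true  refl = inj₂ refl
      good-or-light : ∀ z → stuck y z ≡ true → good z y ≡ true ⊎ light y z ≡ true
      good-or-light z stuck-yz = map₁ (trans (good-sym z y)) (split (unsupported y z) (proj₁ (∧-elim stuck-yz)))

    stuck-cherry-bound : ∀ a →
      a * n * count₂ stuck ≤ a * a * |P₂| good stuck + (n * (n * n) + a * n * count₂ light)
    stuck-cherry-bound a = begin
      a * n * count₂ stuck
        ≡⟨ trans (cong (a * n *_) (count₂≡∑ stuck)) (sym (∑-*ˡ (a * n) s)) ⟩
      ∑ (λ y → a * n * s y)
        ≤⟨ ∑-mono-≤ (λ y → threshold-bound a n (f y) (s y) (l y) (|stuck|≤|good|+|light| y)) ⟩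
      ∑ (λ y → a * a * (f y * s y) + (n * n + a * n * l y))
        ≡⟨ ∑-distrib-+ (λ y → a * a * (f y * s y)) (λ y → n * n + a * n * l y) ⟩
      ∑ (λ y → a * a * (f y * s y)) + ∑ (λ y → n * n + a * n * l y)
        ≡⟨ cong (∑ (λ y → a * a * (f y * s y)) +_) (∑-distrib-+ (λ _ → n * n) (λ y → a * n * l y)) ⟩
      ∑ (λ y → a * a * (f y * s y)) + (∑ {n} (λ _ → n * n) + ∑ (λ y → a * n * l y))
        ≡⟨ cong₂ _+_ (∑-*ˡ (a * a) (λ y → f y * s y)) (cong₂ _+_ (∑-const n (n * n)) (∑-*ˡ (a * n) l)) ⟩
      a * a * ∑ (λ y → f y * s y) + (n * (n * n) + a * n * ∑ l)
        ≡⟨ cong₂ (λ p q → a * a * p + (n * (n * n) + a * n * q)) (|P₂|≡∑ good stuck) (count₂≡∑ light) ⟨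
      a * a * |P₂| good stuck + (n * (n * n) + a * n * count₂ light)
        ∎
      where
      open ≤-Reasoning
      f s l : Fin n → ℕ
      f y = count (λ x → good x y)
      s y = count (stuck y)
      l y = count (light y)

    orderedUnsupported : Fin n → Fin n → Bool
    orderedUnsupported x y = (toℕ x <ᵇ toℕ y) ∧ unsupported x y

    |light|≤2|unsupported| : count₂ light ≤ count₂ orderedUnsupported + count₂ orderedUnsupported
    |light|≤2|unsupported| = begin
      count₂ light
        ≤⟨ count₂-∪ light⇒ordered ⟩
      count₂ orderedUnsupported + count₂ (flip orderedUnsupported)
        ≡⟨ cong (count₂ orderedUnsupported +_) (count₂-transpose orderedUnsupported) ⟨
      count₂ orderedUnsupported + count₂ orderedUnsupported
        ∎
      where
      open ≤-Reasoning
      light⇒ordered : ∀ y z → light y z ≡ true →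
                      orderedUnsupported y z ≡ true ⊎ orderedUnsupported z y ≡ true
      light⇒ordered y z light-yz with ∧-elim light-yz
      ... | outer , u with <-cmp (toℕ y) (toℕ z)
      ...   | tri< y<z _ _ = inj₁ (cong₂ _∧_ (<⇒<ᵇ≡true y<z) u)
      ...   | tri≈ _ y≡z _ = ⊥-elim (link-distinct (proj₁ (∧-elim outer)) (toℕ-injective y≡z))
      ...   | tri> _ _ z<y = inj₂ (cong₂ _∧_ (<⇒<ᵇ≡true z<y) (trans (unsupported-sym z y) u))

    e[good,stuck]≡0 : e[ H ] good stuck ≡ 0
    e[good,stuck]≡0 = count₃-empty {P = λ x y z → good x y ∧ stuck y z ∧ edge H x y z} λ x y z cherry-in-H →
      let good-xy , stuck-yz , xyz = ∧-elim₃ {good x y} {stuck y z} cherry-in-H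
      in  true≢false (trans (sym (extendable-intro good-xy xyz)) (not-injective (proj₂ (∧-elim stuck-yz))))
      where
      true≢false : true ≢ false
      true≢false ()

    good⇒large : ∀ {b} → DegreeDichotomy H' b → ∀ {x y} → good x y ≡ true → b ℚ.≤ ⟦ deg₂ H' x y ⟧
    good⇒large dichotomy good-xy =
      let outer , supported = ∧-elim good-xy
      in  dichotomy⇒large {G = H'} dichotomy (link-distinct (proj₁ (∧-elim outer)))
                                             (≡ᵇ0≡false⇒≢0 (not-injective supported))

    GoodAbsorber : ℚ → Set
    GoodAbsorber b = ∃[ v₁ ] ∃[ v₂ ] ∃[ v₃ ] ∃[ v₄ ]
      (Absorber H v v₁ v₂ v₃ v₄
      × W v₁ ≡ false × W v₂ ≡ false × W v₃ ≡ false × W v₄ ≡ false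
      × b ℚ.≤ ⟦ deg₂ H' v₁ v₂ ⟧ × b ℚ.≤ ⟦ deg₂ H' v₃ v₄ ⟧)

    absorbing⇒absorber : ∀ {b} → DegreeDichotomy H' b → ∀ {y z} → absorbing y z ≡ true → GoodAbsorber b
    absorbing⇒absorber dichotomy {y} {z} absorbing-yz =
      let outer-yz , ext-yz , ext-zy = ∧-elim₃ absorbing-yz
          x , good-xy , xyz = extendable-elim ext-yz
          w , good-wz , wzy = extendable-elim ext-zy
          link-yz , W-y , W-z = outerLink-elim outer-yz
          link-xy , W-x , _ = outerLink-elim (proj₁ (∧-elim good-xy))
          link-wz , W-w , _ = outerLink-elim (proj₁ (∧-elim good-wz))
          good-zw = trans (good-sym z w) good-wz
      in  x , y , z , w
        , (xyz , edge-rotate wzy , link-xy , link-yz , trans (link-sym z w) link-wz)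
        , W-x , W-y , W-z , W-w
        , good⇒large dichotomy good-xy , good⇒large dichotomy good-zw
      where
      edge-rotate : ∀ {a b c} → edge H a b c ≡ true → edge H c b a ≡ true
      edge-rotate {a} {b} {c} abc =
        trans (sym₁₂ H c b a) (trans (sym₂₃ H b c a) (trans (sym₁₂ H b a c) abc))

    absorbing-pair-exists : ∀ K .{{_ : NonZero K}} {q} →
      n C 2 ≤ K * deg₁ H v → 4 * (n * count W) ≤ deg₁ H v + deg₁ H v + n →
      1024 * (K * K * K) ≤ q → q * |P₂| good stuck ≤ K * n ^ 3 →
      32 * K * count₂ orderedUnsupported ≤ n C 2 → 2 * K + 2 ≤ n →
      ∃[ y ] ∃[ z ] absorbing y z ≡ true
    absorbing-pair-exists K C≤KD 4nw≤2D+n 1024K³≤q q|P₂|≤Kn³ 32Kc≤C 2K+2≤n =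
      count₂>0⇒∃ absorbing (n≢0⇒n>0 λ no-absorbing →
        link-bounds-incompatible K {n} {O} {S}
          (subst (λ g → O ≤ g + (S + S)) no-absorbing |outerLink|≤|absorbing|+2|stuck|)
          (link-lower-bound {K} {n} {n C 2} {D} {count₂ link} {O} {count W}
            (nC2+nC2+n≡n*n n) C≤KD deg₁+deg₁≤|link| |link|≤|outerLink|+2n|W| 4nw≤2D+n)
          (stuck-bound {16 * K} {n} {|P₂| good stuck} {S} {count₂ light}
            (cherry-term-bound K {n = n} 1024K³≤q q|P₂|≤Kn³)
            (light-term-bound K |light|≤2|unsupported| 32Kc≤C (nC2+nC2+n≡n*n n))
            (stuck-cherry-bound (16 * K)))
          2K+2≤n)
      where
      D = deg₁ H v
      O = count₂ outerLink
      S = count₂ stuck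
      instance
        _ : NonZero n
        _ = >-nonZero (≤-trans (ℕ.s≤s ℕ.z≤n) (≤-trans (m≤n+m 2 (2 * K)) 2K+2≤n))

open import Defs
open import Data.Nat as ℕ using (ℕ; _<ᵇ_)
open import Data.Nat.Combinatorics using (_C_)
open import Data.Rational using (ℚ; 0ℚ; 1ℚ; _<_; _≤_; _*_; _/_)
open import Data.Integer using (+_)
open import Data.Fin using (Fin; toℕ)
open import Data.Bool using (Bool; true; false; _∧_)
open import Data.Product using (Σ; _×_; ∃-syntax)
open import Data.Sum using (_⊎_)
open import Relation.Binary.PropositionalEquality using (_≡_)

open import Data.Product using (_,_; proj₁; proj₂)
open import Data.Nat.Properties using (n≤1+n; m≤m*n; m≤n*m; ≤-trans)
open import Data.Rational.Properties using (positive⁻¹; normalize-pos)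
open Arithmetic using (nC2+nC2+n≡n*n; 1024K³≤[32K]⁵)
open Rationals
open Absorbers using (module Link)

lemma2p4 : ∀ (α d : ℚ) → 0ℚ < α → α ≤ 1ℚ → 0ℚ < d → d ≤ 1ℚ →
    ∃[ ρ ] (0ℚ < ρ × ∃[ n₀ ] (∀ (n : ℕ) → n₀ ℕ.≤ n →
      ∀ (H H' : 3Graph n) →
      CherryDense ρ d H →
      δ₁≥ H (α * ⟦ n C 2 ⟧) →
      H' ⊆ᴴ H →
      (∀ (x y : Fin n) → toℕ x ℕ.< toℕ y →
        (d * ⟦ n ⟧ * (+ 1 / 3) ≤ ⟦ deg₂ H' x y ⟧) ⊎ (deg₂ H' x y ≡ 0)) →
      (⟦ count₂ (λ x y → (toℕ x <ᵇ toℕ y) ∧ (deg₂ H' x y ℕ.≡ᵇ 0)) ℕ.^ 5 ⟧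
         ≤ ρ * ⟦ (n C 2) ℕ.^ 5 ⟧) →
      ∀ (v : Fin n) (W : Fin n → Bool) →
      ⟦ count W ⟧ ≤ α * ⟦ n ⟧ * (+ 1 / 4) →
      ∃[ v₁ ] ∃[ v₂ ] ∃[ v₃ ] ∃[ v₄ ]
        (Absorber H v v₁ v₂ v₃ v₄
        × W v₁ ≡ false × W v₂ ≡ false × W v₃ ≡ false × W v₄ ≡ false
        × d * ⟦ n ⟧ * (+ 1 / 3) ≤ ⟦ deg₂ H' v₁ v₂ ⟧
        × d * ⟦ n ⟧ * (+ 1 / 3) ≤ ⟦ deg₂ H' v₃ v₄ ⟧)))
lemma2p4 α d 0<α α≤1 0<d _ = ρ , positive⁻¹ ρ {{normalize-pos 1 q}} , 2 ℕ.* K ℕ.+ 2 ,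
  λ n 2K+2≤n H H' cherryDense δ₁≥ _ dichotomy few-unsupported v W small-W →
    let open Link H H' v W
        _ , _ , absorbing-yz = absorbing-pair-exists K
          (clear-coefficient {α} {K} 1≤Kα (δ₁≥ v))
          (4nw≤2D+n {α} {n} {n C 2} {deg₁ H v} {count W} α≤1 (nC2+nC2+n≡n*n n) (δ₁≥ v) small-W)
          (≤-trans (1024K³≤[32K]⁵ K) (n≤1+n t))
          (cherryDense⇒|P₂|≤ {n} {d} {K} {t} {H} good stuck cherryDense 1≤Kd e[good,stuck]≡0)
          (root-bound 5 {32 ℕ.* K} {t} {count₂ orderedUnsupported} {n C 2} (n≤1+n t) few-unsupported)
          2K+2≤n
    in  absorbing⇒absorber dichotomy absorbing-yz
  where
  kα = proj₁ (archimedean α 0<α)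
  kd = proj₁ (archimedean d 0<d)
  K = ℕ.suc kα ℕ.* ℕ.suc kd
  1≤Kα : 1ℚ ≤ ⟦ K ⟧ * α
  1≤Kα = archimedean-mono 0<α (m≤m*n (ℕ.suc kα) (ℕ.suc kd)) (proj₂ (archimedean α 0<α))
  1≤Kd : 1ℚ ≤ ⟦ K ⟧ * d
  1≤Kd = archimedean-mono 0<d (m≤n*m (ℕ.suc kd) (ℕ.suc kα)) (proj₂ (archimedean d 0<d))
  -- ρ ≤ (32K)⁻⁵ leaves at most C(n,2)/(32K) pairs of H'-degree 0, and ρ ≤ 1/(1024K³)
  -- leaves at most n³/(1024K²) cherries from good to stuck pairs.
  t = (32 ℕ.* K) ℕ.^ 5
  q = ℕ.suc t
  ρ = + 1 / q
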